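{- Let $M=[0,m_1]\times\cdots\times[0,m_d]$ with $m_i$ positive integers, and let $H$ be a maximal system of brick islands in $M$. Suppose $|Max(H)|>1$ and $R=[r_{1,1},r_{1,2}]\times\cdots\times[r_{d,1},r_{d,2}]\in Max(H)$. Then $r_{i,1}\neq 1$ and $r_{i,2}\neq m_i-1$ for every $1\le i\le d$.
   Context: A brick of $M$ is a set $[a_1,b_1]\times\cdots\times[a_d,b_d]$ with $a_i,b_i\in\mathbb{Z}$, $0\le a_i<b_i\le m_i$. A system of brick islands in $M$ is a set $H$ of bricks of $M$ such that any two members are either nested or disjoint; it is maximal if it is not properly contained in another system of brick islands in $M$. For such $H$, $Max(H)$ denotes the set of maximal elements of $H\setminus\{M\}$ with respect to inclusion. -}

module Defs where

open import Data.Nat using (ℕ; _≤_; _<_)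
open import Data.Fin using (Fin)
open import Data.Product using (_×_; Σ; ∃)
open import Data.Sum using (_⊎_)
open import Relation.Nullary using (¬_)
open import Level using (suc; zero)

-- The box M = [0,m_1] × ... × [0,m_d], given by the vector m of positive sizes.
-- A brick of M: [a_1,b_1] × ... × [a_d,b_d], integers 0 ≤ a_i < b_i ≤ m_i.
record Brick {d : ℕ} (m : Fin d → ℕ) : Set where
  constructor brick
  field
    lo   : Fin d → ℕ
    hi   : Fin d → ℕ
    lo<hi : ∀ i → lo i < hi i
    hi≤m : ∀ i → hi i ≤ m i
open Brick public

module _ {d : ℕ} {m : Fin d → ℕ} where

  -- a lattice point lies in a brick (bricks have integer corners, so
  -- inclusion / disjointness of the real bricks is detected on lattice points)
  _∈B_ : (Fin d → ℕ) → Brick m → Set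
  p ∈B B = ∀ i → lo B i ≤ p i × p i ≤ hi B i

  _⊆B_ : Brick m → Brick m → Set
  A ⊆B B = ∀ p → p ∈B A → p ∈B B

  _≐_ : Brick m → Brick m → Set
  A ≐ B = A ⊆B B × B ⊆B A

  Disjoint : Brick m → Brick m → Set
  Disjoint A B = ∀ p → p ∈B A → ¬ (p ∈B B)

  NestedOrDisjoint : Brick m → Brick m → Set
  NestedOrDisjoint A B = A ⊆B B ⊎ B ⊆B A ⊎ Disjoint A B

Mbrick : {d : ℕ} (m : Fin d → ℕ) → (∀ i → 0 < m i) → Brick m
Mbrick m pos = brick (λ _ → 0) m pos (λ _ → Data.Nat.Properties.≤-refl)
  where import Data.Nat.Properties

BrickSet : {d : ℕ} (m : Fin d → ℕ) → Set₁
BrickSet m = Brick m → Set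

module _ {d : ℕ} {m : Fin d → ℕ} where

  IsSystem : BrickSet m → Set
  IsSystem H = ∀ A B → H A → H B → NestedOrDisjoint A B

  IsMaximalSystem : BrickSet m → Set₁
  IsMaximalSystem H =
    IsSystem H × (∀ (K : BrickSet m) → IsSystem K → (∀ A → H A → K A) → ∀ A → K A → H A)

InMax : {d : ℕ} (m : Fin d → ℕ) (pos : ∀ i → 0 < m i) → BrickSet m → Brick m → Set
InMax m pos H R =
  H R × ¬ (R ≐ Mbrick m pos) ×
  (∀ S → H S → ¬ (S ≐ Mbrick m pos) → R ⊆B S → S ≐ R)

MaxHasTwo : {d : ℕ} (m : Fin d → ℕ) (pos : ∀ i → 0 < m i) → BrickSet m → Set
MaxHasTwo m pos H =
  Σ (Brick m) λ R → Σ (Brick m) λ S → InMax m pos H R × InMax m pos H S × ¬ (R ≐ S)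

-- Suppose lo R i = 1 (the case hi R i = m i - 1 is symmetric).  Push
-- the i-th lower face of R down to 0; call the result R'.  Because corners
-- are integers, a brick meeting the slab 0 ≤ x_i ≤ 1 of R' also meets the
-- plane x_i = 1, so every brick meeting R' already meets R.  Consequently
-- R' is nested with or disjoint from every member of H, and maximality of H
-- puts R' into H.  As R is maximal in H \ {M} and R ⊊ R', we get R' = M.
-- But then every brick meets R, which forces every member of Max(H) to be
-- R itself, contradicting |Max(H)| > 1.

module Submission where

open import Defs
open import Data.Nat using (ℕ; _<_; _≤_; _∸_; z≤n; s≤s; _⊔_; _⊓_)
open import Data.Nat.Properties
  using (≤-refl; ≤-trans; <⇒≤; <⇒≱; ≤-antisym; n≤0⇒n≡0; ∸-monoʳ-<;
         m≤m⊔n; m≤n⊔m; ⊔-lub; m⊓n≤m; m⊓n≤n; ⊓-glb)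
  renaming (_≟_ to _≟ℕ_)
open import Data.Fin using (Fin; _≟_)
open import Data.Fin.Properties using (all?)
open import Data.Vec.Functional using (updateAt)
open import Data.Vec.Functional.Properties using (updateAt-updates; updateAt-minimal)
open import Data.Product using (Σ; _×_; _,_; proj₁; proj₂; swap)
open import Data.Sum using (_⊎_; inj₁; inj₂)
open import Data.Empty using (⊥-elim)
open import Function using (const)
open import Relation.Nullary using (¬_; Dec; yes; no; _×-dec_)
open import Relation.Binary.PropositionalEquality using (_≡_; _≢_; refl; sym; subst; subst₂)

_∈[_,_] : ℕ → ℕ → ℕ → Set
x ∈[ a , b ] = a ≤ x × x ≤ b

<⇒≤∸1 : ∀ {a b} → a < b → a ≤ b ∸ 1
<⇒≤∸1 (s≤s a≤b) = a≤b

module _ {d : ℕ} where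

  _[_]≔_ : (Fin d → ℕ) → Fin d → ℕ → Fin d → ℕ
  f [ i ]≔ v = updateAt f i (const v)

  update-pointwise : (P : Fin d → ℕ → ℕ → Set) {f g : Fin d → ℕ} (i : Fin d) {u v : ℕ} →
    P i u v → (∀ j → j ≢ i → P j (f j) (g j)) → ∀ j → P j ((f [ i ]≔ u) j) ((g [ i ]≔ v) j)
  update-pointwise P {f} {g} i {u} {v} Pi Pj j with j ≟ i
  ... | yes refl rewrite updateAt-updates i {const u} f | updateAt-updates i {const v} g = Pi
  ... | no j≢i rewrite updateAt-minimal j i {const u} f j≢i
                     | updateAt-minimal j i {const v} g j≢i = Pj j j≢i

  update-elim : (P : Fin d → ℕ → Set) {f : Fin d → ℕ} (i : Fin d) {v : ℕ} →
    P i v → (∀ j → j ≢ i → P j (f j)) → ∀ j → P j ((f [ i ]≔ v) j)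
  update-elim P {f} i {v} = update-pointwise (λ j u _ → P j u) {f} {f} i {v} {v}

module _ {d : ℕ} {m : Fin d → ℕ} where

  Meets : Brick m → Brick m → Set
  Meets A B = Σ (Fin d → ℕ) λ p → p ∈B A × p ∈B B

  MeetsThrough : Brick m → Brick m → Set
  MeetsThrough R' R = ∀ B → Meets B R' → Meets B R

  ≐-trans : {A B C : Brick m} → A ≐ B → B ≐ C → A ≐ C
  ≐-trans (A⊆B , B⊆A) (B⊆C , C⊆B) =
    (λ p p∈A → B⊆C p (A⊆B p p∈A)) , (λ p p∈C → B⊆A p (C⊆B p p∈C))

  lo∈ : (A : Brick m) → lo A ∈B A
  lo∈ A j = ≤-refl , <⇒≤ (lo<hi A j)

  hi∈ : (A : Brick m) → hi A ∈B A
  hi∈ A j = <⇒≤ (lo<hi A j) , ≤-refl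

  nestedOrDisjoint-sym : {A B : Brick m} → NestedOrDisjoint A B → NestedOrDisjoint B A
  nestedOrDisjoint-sym (inj₁ A⊆B) = inj₂ (inj₁ A⊆B)
  nestedOrDisjoint-sym (inj₂ (inj₁ B⊆A)) = inj₁ B⊆A
  nestedOrDisjoint-sym (inj₂ (inj₂ disj)) = inj₂ (inj₂ λ p p∈B p∈A → disj p p∈A p∈B)

  ∈-update : (B : Brick m) (p : Fin d → ℕ) (i : Fin d) {y : ℕ} → y ∈[ lo B i , hi B i ] →
    (∀ j → j ≢ i → p j ∈[ lo B j , hi B j ]) → (p [ i ]≔ y) ∈B B
  ∈-update B p i = update-elim (λ j v → v ∈[ lo B j , hi B j ]) i

module _ {d : ℕ} {m : Fin d → ℕ} (pos : ∀ i → 0 < m i) where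

  private
    M : Brick m
    M = Mbrick m pos

  ⊆M : (A : Brick m) → A ⊆B M
  ⊆M A p p∈A j = z≤n , ≤-trans (proj₂ (p∈A j)) (hi≤m A j)

  -- A brick equals M exactly when its corners are those of M; this makes
  -- equality with M decidable.
  Corners-of-M : Brick m → Set
  Corners-of-M A = ∀ j → lo A j ≡ 0 × hi A j ≡ m j

  ≐M⇒corners : (A : Brick m) → A ≐ M → Corners-of-M A
  ≐M⇒corners A (_ , M⊆A) j =
    n≤0⇒n≡0 (proj₁ (M⊆A (λ _ → 0) (lo∈ M) j)) ,
    ≤-antisym (hi≤m A j) (proj₂ (M⊆A m (hi∈ M) j))

  corners⇒≐M : (A : Brick m) → Corners-of-M A → A ≐ M
  corners⇒≐M A corners = ⊆M A , λ p p∈M j →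
    subst (_≤ p j) (sym (proj₁ (corners j))) z≤n ,
    subst (p j ≤_) (sym (proj₂ (corners j))) (proj₂ (p∈M j))

  ≐M? : (A : Brick m) → Dec (A ≐ M)
  ≐M? A with all? (λ j → (lo A j ≟ℕ 0) ×-dec (hi A j ≟ℕ m j))
  ... | yes corners = yes (corners⇒≐M A corners)
  ... | no ¬corners = no λ A≐M → ¬corners (≐M⇒corners A A≐M)

module Extension {d : ℕ} {m : Fin d → ℕ} (pos : ∀ i → 0 < m i) (H : BrickSet m)
  (maximal : IsMaximalSystem H) (R : Brick m) (R∈Max : InMax m pos H R) where

  private
    system : IsSystem H
    system = proj₁ maximal

    R∈H : H R
    R∈H = proj₁ R∈Max

    R≢M : ¬ (R ≐ Mbrick m pos)
    R≢M = proj₁ (proj₂ R∈Max)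

    R-top : ∀ S → H S → ¬ (S ≐ Mbrick m pos) → R ⊆B S → S ≐ R
    R-top = proj₂ (proj₂ R∈Max)

  -- R' is nested with or disjoint from every member of H: a member above R
  -- is M or R itself, one below R lies below R', and one disjoint from R
  -- cannot meet R' without meeting R.
  extension-compatible : (R' : Brick m) → R ⊆B R' → MeetsThrough R' R →
    ∀ B → H B → NestedOrDisjoint R' B
  extension-compatible R' R⊆R' through B B∈H with system R B R∈H B∈H
  ... | inj₁ R⊆B with ≐M? pos B
  ...   | yes B≐M = inj₁ λ p p∈R' → proj₂ B≐M p (⊆M pos R' p p∈R')
  ...   | no B≢M = inj₂ (inj₁ λ p p∈B → R⊆R' p (proj₁ (R-top B B∈H B≢M R⊆B) p p∈B))
  extension-compatible R' R⊆R' through B B∈H | inj₂ (inj₁ B⊆R) =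
    inj₂ (inj₁ λ p p∈B → R⊆R' p (B⊆R p p∈B))
  extension-compatible R' R⊆R' through B B∈H | inj₂ (inj₂ R∩B=∅) =
    inj₂ (inj₂ λ p p∈R' p∈B →
      let (q , q∈B , q∈R) = through B (p , p∈B , p∈R') in R∩B=∅ q q∈R q∈B)

  -- By maximality of H, adding the compatible brick R' changes nothing.
  extension-in-H : (R' : Brick m) → R ⊆B R' → MeetsThrough R' R → H R'
  extension-in-H R' R⊆R' through = proj₂ maximal K K-system (λ _ → inj₁) R' (inj₂ refl)
    where
    K : BrickSet m
    K A = H A ⊎ A ≡ R'

    compatible : ∀ B → H B → NestedOrDisjoint R' B
    compatible = extension-compatible R' R⊆R' through

    K-system : IsSystem K
    K-system A B (inj₁ A∈H) (inj₁ B∈H) = system A B A∈H B∈H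
    K-system A _ (inj₁ A∈H) (inj₂ refl) = nestedOrDisjoint-sym {A = R'} {A} (compatible A A∈H)
    K-system _ B (inj₂ refl) (inj₁ B∈H) = compatible B B∈H
    K-system _ _ (inj₂ refl) (inj₂ refl) = inj₁ λ p p∈R' → p∈R'

  -- R is maximal in H \ {M}, so a proper extension of R lying in H is M.
  proper-extension-is-M : (R' : Brick m) → R ⊆B R' → MeetsThrough R' R → ¬ (R' ⊆B R) →
    R' ≐ Mbrick m pos
  proper-extension-is-M R' R⊆R' through R'⊈R with ≐M? pos R'
  ... | yes R'≐M = R'≐M
  ... | no R'≢M = ⊥-elim (R'⊈R (proj₁ (R-top R' (extension-in-H R' R⊆R' through) R'≢M R⊆R')))

  -- If every brick meets R, any member of Max(H) is nested with R, hence equal to it.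
  meets-all⇒unique : (∀ B → Meets B R) → ∀ T → InMax m pos H T → T ≐ R
  meets-all⇒unique meets-R T (T∈H , T≢M , T-top) with system T R T∈H R∈H
  ... | inj₁ T⊆R = swap (T-top R R∈H R≢M T⊆R)
  ... | inj₂ (inj₁ R⊆T) = R-top T T∈H T≢M R⊆T
  ... | inj₂ (inj₂ T∩R=∅) = let (p , p∈T , p∈R) = meets-R T in ⊥-elim (T∩R=∅ p p∈T p∈R)

  no-proper-extension : MaxHasTwo m pos H → (R' : Brick m) → R ⊆B R' → MeetsThrough R' R →
    ¬ ¬ (R' ⊆B R)
  no-proper-extension (T , S , T∈Max , S∈Max , T≢S) R' R⊆R' through R'⊈R =
    T≢S (≐-trans {A = T} {R} {S} (unique T T∈Max) (swap (unique S S∈Max)))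
    where
    R'≐M : R' ≐ Mbrick m pos
    R'≐M = proper-extension-is-M R' R⊆R' through R'⊈R

    meets-R : ∀ B → Meets B R
    meets-R B = through B (lo B , lo∈ B , proj₂ R'≐M (lo B) (⊆M pos B (lo B) (lo∈ B)))

    unique : ∀ T → InMax m pos H T → T ≐ R
    unique = meets-all⇒unique meets-R

IntervalMeetsThrough : (n a' b' a b : ℕ) → Set
IntervalMeetsThrough n a' b' a b = ∀ {c e x} → c < e → e ≤ n → x ∈[ c , e ] → x ∈[ a' , b' ] →
  Σ ℕ λ y → y ∈[ c , e ] × y ∈[ a , b ]

module Widening {d : ℕ} {m : Fin d → ℕ} (R : Brick m) (i : Fin d) {a' b' : ℕ}
  (a'≤lo : a' ≤ lo R i) (hi≤b' : hi R i ≤ b') (b'≤m : b' ≤ m i) where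

  widened : Brick m
  widened = brick (lo R [ i ]≔ a') (hi R [ i ]≔ b')
    (update-pointwise (λ _ u v → u < v) i (≤-trans (s≤s a'≤lo) (≤-trans (lo<hi R i) hi≤b'))
      (λ j _ → lo<hi R j))
    (update-elim (λ j v → v ≤ m j) i b'≤m (λ j _ → hi≤m R j))

  R⊆widened : R ⊆B widened
  R⊆widened p p∈R = update-pointwise (λ j u v → p j ∈[ u , v ]) i
    (≤-trans a'≤lo (proj₁ (p∈R i)) , ≤-trans (proj₂ (p∈R i)) hi≤b') (λ j _ → p∈R j)

  ∈widened-at : ∀ p → p ∈B widened → p i ∈[ a' , b' ]
  ∈widened-at p p∈W =
    subst₂ (λ u v → p i ∈[ u , v ]) (updateAt-updates i (lo R)) (updateAt-updates i (hi R)) (p∈W i)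

  ∈widened-elsewhere : ∀ p → p ∈B widened → ∀ j → j ≢ i → p j ∈[ lo R j , hi R j ]
  ∈widened-elsewhere p p∈W j j≢i =
    subst₂ (λ u v → p j ∈[ u , v ])
      (updateAt-minimal j i (lo R) j≢i) (updateAt-minimal j i (hi R) j≢i) (p∈W j)

  -- A strict enlargement gives a proper extension: a corner of the widened
  -- brick leaves R.
  widened-proper : a' < lo R i ⊎ hi R i < b' → ¬ (widened ⊆B R)
  widened-proper (inj₁ a'<lo) W⊆R = <⇒≱ a'<lo
    (subst (lo R i ≤_) (updateAt-updates i (lo R)) (proj₁ (W⊆R (lo widened) (lo∈ widened) i)))
  widened-proper (inj₂ hi<b') W⊆R = <⇒≱ hi<b'
    (subst (_≤ hi R i) (updateAt-updates i (hi R)) (proj₂ (W⊆R (hi widened) (hi∈ widened) i)))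

  -- A brick meeting the widened brick at p meets R at p with its i-th
  -- coordinate moved into [lo R i , hi R i], by the one-dimensional hypothesis.
  widened-meets-through : IntervalMeetsThrough (m i) a' b' (lo R i) (hi R i) →
    MeetsThrough widened R
  widened-meets-through interval B (p , p∈B , p∈W) =
    let (y , y∈B , y∈R) = interval (lo<hi B i) (hi≤m B i) (p∈B i) (∈widened-at p p∈W)
    in (p [ i ]≔ y) , ∈-update B p i y∈B (λ j _ → p∈B j) ,
       ∈-update R p i y∈R (∈widened-elsewhere p p∈W)

no-proper-widening : {d : ℕ} {m : Fin d → ℕ} (pos : ∀ i → 0 < m i) (H : BrickSet m) →
  IsMaximalSystem H → MaxHasTwo m pos H → (R : Brick m) → InMax m pos H R →
  (i : Fin d) {a' b' : ℕ} (a'≤lo : a' ≤ lo R i) (hi≤b' : hi R i ≤ b') (b'≤m : b' ≤ m i) →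
  a' < lo R i ⊎ hi R i < b' → ¬ IntervalMeetsThrough (m i) a' b' (lo R i) (hi R i)
no-proper-widening pos H maximal two R R∈Max i a'≤lo hi≤b' b'≤m strict interval =
  no-proper-extension two widened R⊆widened (widened-meets-through interval) (widened-proper strict)
  where
  open Extension pos H maximal R R∈Max
  open Widening R i a'≤lo hi≤b' b'≤m

-- (5) The two interval facts behind the corollary, both resting on the
-- integrality of corners.  A nondegenerate interval meeting [0 , b] meets
-- [1 , b] (move a point x to x ⊔ 1) ...
lower-slab : ∀ n b → 1 ≤ b → IntervalMeetsThrough n 0 b 1 b
lower-slab n b 1≤b {c} {e} {x} c<e _ (c≤x , x≤e) (_ , x≤b) =
  x ⊔ 1 , (≤-trans c≤x (m≤m⊔n x 1) , ⊔-lub x≤e (≤-trans (s≤s z≤n) c<e)) ,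
          (m≤n⊔m x 1 , ⊔-lub x≤b 1≤b)

-- ... and, inside [0 , n], one meeting [a , n] meets [a , n - 1]
-- (move x to x ⊓ (n - 1)).
upper-slab : ∀ n a → a ≤ n ∸ 1 → IntervalMeetsThrough n a n a (n ∸ 1)
upper-slab n a a≤n-1 {c} {e} {x} c<e e≤n (c≤x , x≤e) (a≤x , _) =
  x ⊓ (n ∸ 1) , (⊓-glb c≤x (<⇒≤∸1 (≤-trans c<e e≤n)) , ≤-trans (m⊓n≤m x _) x≤e) ,
               (⊓-glb a≤x a≤n-1 , m⊓n≤n x _)

-- The corollary: if lo R i = 1, widening the i-th interval down to 0 is a
-- strict enlargement seen through [1 , hi R i]; if hi R i = m i - 1,
-- widening it up to m i is one seen through [lo R i , m i - 1].
corollary1 : (d : ℕ) (m : Fin d → ℕ) (pos : ∀ i → 0 < m i) (H : BrickSet m) →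
    IsMaximalSystem H → MaxHasTwo m pos H →
    (R : Brick m) → InMax m pos H R →
    ∀ i → (lo R i ≢ 1) × (hi R i ≢ m i ∸ 1)
corollary1 d m pos H maximal two R R∈Max i = lo≢1 , hi≢m-1
  where
  no-widening : ∀ {a' b'} → a' ≤ lo R i → hi R i ≤ b' → b' ≤ m i →
    a' < lo R i ⊎ hi R i < b' → ¬ IntervalMeetsThrough (m i) a' b' (lo R i) (hi R i)
  no-widening = no-proper-widening pos H maximal two R R∈Max i

  lo≢1 : lo R i ≢ 1
  lo≢1 lo≡1 = no-widening z≤n ≤-refl (hi≤m R i) (inj₁ (subst (0 <_) (sym lo≡1) (s≤s z≤n)))
    (subst (λ a → IntervalMeetsThrough (m i) 0 (hi R i) a (hi R i)) (sym lo≡1)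
      (lower-slab (m i) (hi R i) (≤-trans (s≤s z≤n) (lo<hi R i))))

  hi≢m-1 : hi R i ≢ m i ∸ 1
  hi≢m-1 hi≡m-1 = no-widening ≤-refl (hi≤m R i) ≤-refl
    (inj₂ (subst (_< m i) (sym hi≡m-1) (∸-monoʳ-< (s≤s z≤n) (pos i))))
    (subst (λ b → IntervalMeetsThrough (m i) (lo R i) (m i) (lo R i) b) (sym hi≡m-1)
      (upper-slab (m i) (lo R i) (subst (lo R i ≤_) hi≡m-1 (<⇒≤ (lo<hi R i)))))
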